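{- Let $d\geq 1$. Among all $d$-dimensional simplicial complexes $K$ with $(K)^d\in\mathcal{F}_d$, the complex $((\Delta_2)^{\leq 0})^{*(d+1)}$ has the maximal number of vertices and the minimal number of $d$-simplices.
   Context: A simplicial complex $K$ with vertex set identified with a subset of $[n]$ is nice on $[n]$ if for every $F \subseteq [n]$ exactly one of $F$ and $[n]\setminus F$ belongs to $K$. The join $K_1*K_2$ has vertex set $V(K_1)\sqcup V(K_2)$ and simplices $F_1\sqcup F_2$ with $F_i\in K_i$; $L^{*m}$ is the $m$-fold join of $L$ with itself. $(\Delta_2)^{\le 0}$ is the complex consisting of three vertices (and the empty set). For a $d$-dimensional complex $K$, $(K)^d$ denotes the $(d+1)$-graph on $V(K)$ whose edges are the $d$-simplices of $K$. For $d\ge1$, $\mathcal{F}_d$ is the family of all $(d+1)$-graphs $(K_1*\cdots*K_s)^d$ where $s\ge1$, each $K_i$ is nice on $[n_i]$, $\dim(K_1*\cdots*K_s)=d$ and $n_1+\dots+n_s=2d+s+2$. -}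

module Defs where

open import Data.Nat using (ℕ; zero; suc; _+_; _*_; _≤_; _≤ᵇ_; _≡ᵇ_)
open import Data.Bool using (Bool; true; false; _∧_; _∨_; not; if_then_else_)
open import Data.Fin using (Fin)
open import Data.Fin.Subset using (Subset; ⁅_⁆; ∁; ∣_∣; ⊥; _⊆_)
open import Data.Vec using (Vec; []; _∷_; take; drop; tabulate; lookup)
open import Data.List using (List; []; _∷_; map; length; replicate; allFin)
open import Data.Nat.ListAction using (sum)
open import Data.Bool.ListAction using (any)
open import Data.List.Relation.Unary.All using (All)
open import Data.Product using (Σ; ∃; _×_; _,_; proj₁)
open import Relation.Binary.PropositionalEquality using (_≡_)
open import Relation.Nullary.Decidable using (⌊_⌋)
import Data.Fin as Fin

-- A (candidate) family of faces on the ground set Fin n, given by its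
-- Boolean indicator on subsets of Fin n.
FaceFn : ℕ → Set
FaceFn n = Subset n → Bool

IsComplex : ∀ {n} → FaceFn n → Set
IsComplex {n} K = (K ⊥ ≡ true) × (∀ (F G : Subset n) → G ⊆ F → K F ≡ true → K G ≡ true)

IsVertex : ∀ {n} → FaceFn n → Fin n → Set
IsVertex K i = K ⁅ i ⁆ ≡ true

IsNice : ∀ {n} → FaceFn n → Set
IsNice {n} K = IsComplex K × (∀ (F : Subset n) → K F ≡ not (K (∁ F)))

HasDim : ∀ {n} → ℕ → FaceFn n → Set
HasDim {n} d K = (∃ λ (F : Subset n) → (K F ≡ true) × (∣ F ∣ ≡ suc d))
               × (∀ (F : Subset n) → K F ≡ true → ∣ F ∣ ≤ suc d)

countL : ∀ {A : Set} → (A → Bool) → List A → ℕ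
countL p [] = 0
countL p (x ∷ xs) = if p x then suc (countL p xs) else countL p xs

allSubsets : (n : ℕ) → List (Subset n)
allSubsets zero = [] ∷ []
allSubsets (suc n) = map (true ∷_) (allSubsets n) Data.List.++ map (false ∷_) (allSubsets n)

numVertices : ∀ {n} → FaceFn n → ℕ
numVertices {n} K = countL (λ i → K ⁅ i ⁆) (allFin n)

numFaces : ∀ {n} → ℕ → FaceFn n → ℕ
numFaces {n} d K = countL (λ F → K F ∧ (∣ F ∣ ≡ᵇ suc d)) (allSubsets n)

-- join of two complexes on Fin a and Fin b; ground set Fin (a + b),
-- the first a elements coming from the first complex.
join : ∀ {a b} → FaceFn a → FaceFn b → FaceFn (a + b)
join {a} K L F = K (take a F) ∧ L (drop a F)

sizes : List (Σ ℕ FaceFn) → ℕ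
sizes cs = sum (map proj₁ cs)

-- iterated join K₁ * ⋯ * K_s (the empty join is {∅} on Fin 0)
joinAll : (cs : List (Σ ℕ FaceFn)) → FaceFn (sizes cs)
joinAll [] = λ _ → true
joinAll ((n , K) ∷ cs) = join K (joinAll cs)

image : ∀ {m N} → (Fin m → Fin N) → Subset m → Subset N
image {m} f F = tabulate (λ j → any (λ i → lookup F i ∧ ⌊ f i Fin.≟ j ⌋) (allFin m))

-- The (d+1)-graphs (K)^d and (J)^d (vertex sets V(K), V(J), edges the
-- d-simplices) are isomorphic: mutually inverse bijections f, g between
-- the vertex sets, such that a (d+1)-set of vertices of K is a face of K
-- iff its image is a face of J.
HypIso : ∀ {m N} → ℕ → FaceFn m → FaceFn N → Set
HypIso {m} {N} d K J =
  Σ (Fin m → Fin N) λ f → Σ (Fin N → Fin m) λ g →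
    (∀ i → IsVertex K i → IsVertex J (f i) × (g (f i) ≡ i))
  × (∀ j → IsVertex J j → IsVertex K (g j) × (f (g j) ≡ j))
  × (∀ (F : Subset m) → (∀ i → lookup F i ≡ true → IsVertex K i) →
       ∣ F ∣ ≡ suc d → K F ≡ J (image f F))

InFd : ∀ {m} → ℕ → FaceFn m → Set
InFd d K = ∃ λ (cs : List (Σ ℕ FaceFn)) →
    (1 ≤ length cs)
  × All (λ c → IsNice (Data.Product.proj₂ c)) cs
  × HasDim d (joinAll cs)
  × (sizes cs ≡ 2 * d + length cs + 2)
  × HypIso d K (joinAll cs)

-- (Δ₂)^{≤0}: three vertices and the empty set, on ground set Fin 3
Delta2-0 : FaceFn 3
Delta2-0 F = ∣ F ∣ ≤ᵇ 1

L* : (d : ℕ) → FaceFn (sizes (replicate (suc d) (3 , Delta2-0)))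
L* d = joinAll (replicate (suc d) (3 , Delta2-0))

-- Write (K)^d ≅ (K₁ * ⋯ * K_s)^d with K_i nice on [n_i]. A nice complex on [n] has a face of
-- size ⌊n/2⌋, so the join has a face of size Q = Σ ⌊n_i/2⌋, whence Q ≤ d + 1; on the other hand
-- Σ n_i ≤ 2Q + s, and Σ n_i = 2d + s + 2 forces Q = d + 1 with every n_i = 2q_i + 1 odd and every
-- face of K_i of size at most q_i. Niceness then makes every q_i-subset of [n_i] a face of K_i, so
-- K_i has at least C(2q_i+1, q_i) ≥ 3^{q_i} faces of size q_i and at most 2q_i + 1 ≤ 3q_i vertices
-- (none when q_i = 0). Under joins top faces multiply and vertices add, so K has at least 3^{d+1}
-- d-simplices and at most 3(d+1) vertices, which are exactly the counts of ((Δ₂)^{≤0})^{*(d+1)}.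

module Submission where

open import Defs
open import Data.Bool using (Bool; true; false; _∧_; not; if_then_else_)
open import Data.Bool.ListAction using (any)
open import Data.Bool.Properties using (∧-conicalˡ; ∧-conicalʳ; ∧-identityʳ; ∧-zeroʳ; ¬-not; T-≡; T-∧; ⇔→≡)
open import Data.Empty using (⊥-elim)
open import Data.Fin using (Fin)
import Data.Fin as Fin
open import Data.Fin.Subset using (Subset; ⁅_⁆; ∁; ∣_∣; ⊥; _⊆_)
open import Data.Fin.Subset.Properties using (∣p∣≤n; ∣∁p∣≡n∸∣p∣; drop-∷-⊆; x∈⁅y⁆⇒x≡y; p⊆q⇒∣p∣≤∣q∣)
open import Data.List using (List; []; _∷_; map; length; replicate; allFin)
import Data.List as List
open import Data.List.Properties using (map-tabulate; length-tabulate; length-replicate)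
open import Data.List.Membership.Propositional using (_∈_; _─_; lose)
open import Data.List.Membership.Propositional.Properties using (∈-map⁺; ∈-map⁻; ∈-++⁺ˡ; ∈-++⁺ʳ; ∈-allFin)
open import Data.List.Relation.Unary.All using (All; []; _∷_)
import Data.List.Relation.Unary.All as All
open import Data.List.Relation.Unary.AllPairs using ([]; _∷_)
open import Data.List.Relation.Unary.Any using (here; there; satisfied)
open import Data.List.Relation.Unary.Any.Properties using (any⁺; any⁻)
open import Data.List.Relation.Unary.Unique.Propositional using (Unique)
import Data.List.Relation.Unary.Unique.Propositional.Properties as Unique
open import Data.Nat using (ℕ; zero; suc; _+_; _*_; _^_; _≤_; _≡ᵇ_; z≤n; s≤s; s≤s⁻¹; ⌊_/2⌋)
open import Data.Nat.Properties
open import Data.Nat.Tactic.RingSolver using (solve-∀)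
open import Data.Product using (Σ; ∃; _×_; _,_; proj₁; proj₂)
open import Data.Vec using ([]; _∷_; here; there; _++_; take; drop; lookup; tabulate)
open import Data.Vec.Properties using (∷-injectiveʳ; take++drop≡id; ++-injective; lookup∘tabulate; tabulate∘lookup; tabulate-cong; lookup⇒[]=)
open import Function using (_∘_; id; Equivalence; mk⇔)
open import Relation.Binary.PropositionalEquality hiding (J)
open import Relation.Nullary using (¬_)
open import Relation.Nullary.Decidable using (⌊_⌋; toWitness; fromWitness)

-- Counting and subsets

indicator : Bool → ℕ
indicator b = if b then 1 else 0

≡ᵇ-sound : ∀ {m n} → (m ≡ᵇ n) ≡ true → m ≡ n
≡ᵇ-sound {m} {n} eq = ≡ᵇ⇒≡ m n (Equivalence.from T-≡ eq)

countL-∷ : ∀ {A : Set} (p : A → Bool) x xs → countL p (x ∷ xs) ≡ indicator (p x) + countL p xs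
countL-∷ p x xs with p x
... | true = refl
... | false = refl

countL-++ : ∀ {A : Set} (p : A → Bool) xs ys → countL p (xs List.++ ys) ≡ countL p xs + countL p ys
countL-++ p [] ys = refl
countL-++ p (x ∷ xs) ys with p x
... | true = cong suc (countL-++ p xs ys)
... | false = countL-++ p xs ys

countL-map : ∀ {A B : Set} (p : B → Bool) (f : A → B) xs → countL p (map f xs) ≡ countL (p ∘ f) xs
countL-map p f [] = refl
countL-map p f (x ∷ xs) with p (f x)
... | true = cong suc (countL-map p f xs)
... | false = countL-map p f xs

countL-mono : ∀ {A : Set} {p q : A → Bool} → (∀ {x} → p x ≡ true → q x ≡ true) → ∀ xs → countL p xs ≤ countL q xs
countL-mono p⇒q [] = z≤n
countL-mono {p = p} {q} p⇒q (x ∷ xs) with p x in px | q x in qx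
... | true | true = s≤s (countL-mono p⇒q xs)
... | true | false with () ← trans (sym (p⇒q px)) qx
... | false | true = m≤n⇒m≤1+n (countL-mono p⇒q xs)
... | false | false = countL-mono p⇒q xs

countL-none : ∀ {A : Set} {p : A → Bool} → (∀ x → p x ≡ false) → ∀ xs → countL p xs ≡ 0
countL-none none [] = refl
countL-none none (x ∷ xs) rewrite none x = countL-none none xs

countL-≤-length : ∀ {A : Set} (p : A → Bool) xs → countL p xs ≤ length xs
countL-≤-length p [] = z≤n
countL-≤-length p (x ∷ xs) with p x
... | true = s≤s (countL-≤-length p xs)
... | false = m≤n⇒m≤1+n (countL-≤-length p xs)

countL-─ : ∀ {A : Set} (q : A → Bool) {y ys} (y∈ys : y ∈ ys) → q y ≡ true → suc (countL q (ys ─ y∈ys)) ≡ countL q ys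
countL-─ q (here refl) qy rewrite qy = refl
countL-─ q {ys = z ∷ _} (there y∈zs) qy with q z
... | true = cong suc (countL-─ q y∈zs qy)
... | false = countL-─ q y∈zs qy

∈-─ : ∀ {A : Set} {y z : A} {ys} (y∈ys : y ∈ ys) → z ∈ ys → z ≢ y → z ∈ ys ─ y∈ys
∈-─ (here refl) (here refl) z≢y = ⊥-elim (z≢y refl)
∈-─ (here refl) (there z∈ys) _ = z∈ys
∈-─ (there _) (here refl) _ = here refl
∈-─ (there y∈ys) (there z∈ys) z≢y = there (∈-─ y∈ys z∈ys z≢y)

countL-≤-injection : ∀ {A B : Set} {p : A → Bool} {q : B → Bool} (h : A → B) →
  (∀ {x} → p x ≡ true → q (h x) ≡ true) →
  (∀ {x x′} → p x ≡ true → p x′ ≡ true → h x ≡ h x′ → x ≡ x′) →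
  ∀ {xs} → Unique xs → ∀ {ys} → (∀ {x} → x ∈ xs → p x ≡ true → h x ∈ ys) →
  countL p xs ≤ countL q ys
countL-≤-injection h _ _ {[]} _ _ = z≤n
countL-≤-injection {p = p} {q} h pres inj {x ∷ xs} (x∉xs ∷ uniq) {ys} into with p x in px
... | false = countL-≤-injection h pres inj uniq (into ∘ there)
... | true = begin
    suc (countL p xs)               ≤⟨ s≤s (countL-≤-injection h pres inj uniq into′) ⟩
    suc (countL q (ys ─ hx∈ys))     ≡⟨ countL-─ q hx∈ys (pres px) ⟩
    countL q ys                     ∎
  where
  open ≤-Reasoning
  hx∈ys = into (here refl) px
  into′ : ∀ {x′} → x′ ∈ xs → p x′ ≡ true → h x′ ∈ ys ─ hx∈ys
  into′ x′∈xs px′ = ∈-─ hx∈ys (into (there x′∈xs) px′) (λ eq → All.lookup x∉xs x′∈xs (sym (inj px′ px eq)))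

countL-allFin-suc : ∀ n (p : Fin (suc n) → Bool) →
  countL p (allFin (suc n)) ≡ indicator (p Fin.zero) + countL (p ∘ Fin.suc) (allFin n)
countL-allFin-suc n p = begin
  countL p (allFin (suc n))                                ≡⟨ countL-∷ p Fin.zero (List.tabulate Fin.suc) ⟩
  indicator (p Fin.zero) + countL p (List.tabulate Fin.suc) ≡⟨ cong (λ xs → indicator (p Fin.zero) + countL p xs) (sym (map-tabulate {n = n} id Fin.suc)) ⟩
  indicator (p Fin.zero) + countL p (map Fin.suc (allFin n)) ≡⟨ cong (indicator (p Fin.zero) +_) (countL-map p Fin.suc (allFin n)) ⟩
  indicator (p Fin.zero) + countL (p ∘ Fin.suc) (allFin n)  ∎
  where open ≡-Reasoning

allSubsets-complete : ∀ {n} (F : Subset n) → F ∈ allSubsets n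
allSubsets-complete [] = here refl
allSubsets-complete {suc n} (true ∷ F) = ∈-++⁺ˡ (∈-map⁺ (true ∷_) (allSubsets-complete F))
allSubsets-complete {suc n} (false ∷ F) = ∈-++⁺ʳ (map (true ∷_) (allSubsets n)) (∈-map⁺ (false ∷_) (allSubsets-complete F))

allSubsets-unique : ∀ n → Unique (allSubsets n)
allSubsets-unique zero = [] ∷ []
allSubsets-unique (suc n) = Unique.++⁺ (Unique.map⁺ ∷-injectiveʳ (allSubsets-unique n))
                                      (Unique.map⁺ ∷-injectiveʳ (allSubsets-unique n)) disjoint
  where
  disjoint : ∀ {F} → ¬ (F ∈ map (true ∷_) (allSubsets n) × F ∈ map (false ∷_) (allSubsets n))
  disjoint (F∈₁ , F∈₀) with ∈-map⁻ (true ∷_) F∈₁ | ∈-map⁻ (false ∷_) F∈₀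
  ... | _ , _ , refl | _ , _ , ()

∣F∣≡countL : ∀ {n} (F : Subset n) → ∣ F ∣ ≡ countL (lookup F) (allFin n)
∣F∣≡countL [] = refl
∣F∣≡countL (true ∷ F) = trans (cong suc (∣F∣≡countL F)) (sym (countL-allFin-suc _ (lookup (true ∷ F))))
∣F∣≡countL (false ∷ F) = trans (∣F∣≡countL F) (sym (countL-allFin-suc _ (lookup (false ∷ F))))

∣F∣+∣∁F∣≡n : ∀ {n} (F : Subset n) → ∣ F ∣ + ∣ ∁ F ∣ ≡ n
∣F∣+∣∁F∣≡n F = trans (cong (∣ F ∣ +_) (∣∁p∣≡n∸∣p∣ F)) (m+[n∸m]≡n (∣p∣≤n F))

∣F++G∣≡∣F∣+∣G∣ : ∀ {a b} (F : Subset a) (G : Subset b) → ∣ F ++ G ∣ ≡ ∣ F ∣ + ∣ G ∣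
∣F++G∣≡∣F∣+∣G∣ [] G = refl
∣F++G∣≡∣F∣+∣G∣ (true ∷ F) G = cong suc (∣F++G∣≡∣F∣+∣G∣ F G)
∣F++G∣≡∣F∣+∣G∣ (false ∷ F) G = ∣F++G∣≡∣F∣+∣G∣ F G

∣F∣≡∣take∣+∣drop∣ : ∀ a {b} (F : Subset (a + b)) → ∣ F ∣ ≡ ∣ take a F ∣ + ∣ drop a F ∣
∣F∣≡∣take∣+∣drop∣ a F = trans (cong ∣_∣ (sym (take++drop≡id a F))) (∣F++G∣≡∣F∣+∣G∣ (take a F) (drop a F))

take-++ : ∀ {a b} (F : Subset a) (G : Subset b) → take a (F ++ G) ≡ F
take-++ {a} F G = proj₁ (++-injective (take a (F ++ G)) F (take++drop≡id a (F ++ G)))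

drop-++ : ∀ {a b} (F : Subset a) (G : Subset b) → drop a (F ++ G) ≡ G
drop-++ {a} F G = proj₂ (++-injective (take a (F ++ G)) F (take++drop≡id a (F ++ G)))

take-⊥ : ∀ a {b} → take a (⊥ {a + b}) ≡ ⊥
take-⊥ zero = refl
take-⊥ (suc a) = cong (false ∷_) (take-⊥ a)

drop-⊥ : ∀ a {b} → drop a (⊥ {a + b}) ≡ ⊥
drop-⊥ zero = refl
drop-⊥ (suc a) = drop-⊥ a

take-⊆ : ∀ a {b} {F G : Subset (a + b)} → G ⊆ F → take a G ⊆ take a F
take-⊆ (suc a) {b} {_ ∷ _} {_ ∷ _} G⊆F here with G⊆F here
... | here = here
take-⊆ (suc a) {b} {_ ∷ _} {_ ∷ _} G⊆F (there i∈G) = there (take-⊆ a (drop-∷-⊆ G⊆F) i∈G)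

drop-⊆ : ∀ a {b} {F G : Subset (a + b)} → G ⊆ F → drop a G ⊆ drop a F
drop-⊆ zero G⊆F = G⊆F
drop-⊆ (suc a) {b} {_ ∷ _} {_ ∷ _} G⊆F = drop-⊆ a (drop-∷-⊆ G⊆F)

Subset-ext : ∀ {n} {F G : Subset n} → (∀ i → lookup F i ≡ true → lookup G i ≡ true) →
  (∀ i → lookup G i ≡ true → lookup F i ≡ true) → F ≡ G
Subset-ext {F = F} {G} F⊆G G⊆F = begin
  F                   ≡⟨ tabulate∘lookup F ⟨
  tabulate (lookup F) ≡⟨ tabulate-cong (λ i → ⇔→≡ (mk⇔ (F⊆G i) (G⊆F i))) ⟩
  tabulate (lookup G) ≡⟨ tabulate∘lookup G ⟩
  G                   ∎
  where open ≡-Reasoning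

module _ {m N : ℕ} (f : Fin m → Fin N) where

  lookup-image : ∀ F j → lookup (image f F) j ≡ any (λ i → lookup F i ∧ ⌊ f i Fin.≟ j ⌋) (allFin m)
  lookup-image F j = lookup∘tabulate _ j

  image-∈⁻ : ∀ F j → lookup (image f F) j ≡ true → ∃ λ i → (lookup F i ≡ true) × (f i ≡ j)
  image-∈⁻ F j j∈ with satisfied (any⁻ _ (allFin m) (Equivalence.from T-≡ (trans (sym (lookup-image F j)) j∈)))
  ... | i , Fi∧fi≡j with Equivalence.to T-∧ Fi∧fi≡j
  ...   | Fi , fi≡j = i , Equivalence.to T-≡ Fi , toWitness fi≡j

  image-∈⁺ : ∀ F i → lookup F i ≡ true → lookup (image f F) (f i) ≡ true
  image-∈⁺ F i i∈ = trans (lookup-image F (f i))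
    (Equivalence.to T-≡ (any⁺ _ (lose (∈-allFin i) (Equivalence.from T-∧ (Equivalence.from T-≡ i∈ , fromWitness refl)))))

image-id : ∀ {n} (F : Subset n) → image id F ≡ F
image-id F = Subset-ext to (λ i → image-∈⁺ id F i)
  where
  to : ∀ i → lookup (image id F) i ≡ true → lookup F i ≡ true
  to i i∈ with image-∈⁻ id F i i∈
  ... | _ , i∈F , refl = i∈F

module _ {m N : ℕ} (f : Fin m → Fin N) (g : Fin N → Fin m) {F : Subset m}
         (g∘f≡id : ∀ {i} → lookup F i ≡ true → g (f i) ≡ i) where

  image-cancel : image g (image f F) ≡ F
  image-cancel = Subset-ext to from
    where
    to : ∀ i → lookup (image g (image f F)) i ≡ true → lookup F i ≡ true
    to i i∈ with image-∈⁻ g (image f F) i i∈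
    ... | j , j∈ , refl with image-∈⁻ f F j j∈
    ...   | i′ , i′∈ , refl = subst (λ k → lookup F k ≡ true) (sym (g∘f≡id i′∈)) i′∈
    from : ∀ i → lookup F i ≡ true → lookup (image g (image f F)) i ≡ true
    from i i∈ = subst (λ k → lookup (image g (image f F)) k ≡ true) (g∘f≡id i∈)
                      (image-∈⁺ g (image f F) (f i) (image-∈⁺ f F i i∈))

  ∣image∣≡∣F∣ : ∣ image f F ∣ ≡ ∣ F ∣
  ∣image∣≡∣F∣ = begin
    ∣ image f F ∣                          ≡⟨ ∣F∣≡countL (image f F) ⟩
    countL (lookup (image f F)) (allFin N) ≡⟨ ≤-antisym ≤F F≤ ⟩
    countL (lookup F) (allFin m)           ≡⟨ ∣F∣≡countL F ⟨
    ∣ F ∣                                  ∎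
    where
    open ≡-Reasoning
    f-injective : ∀ {i i′} → lookup F i ≡ true → lookup F i′ ≡ true → f i ≡ f i′ → i ≡ i′
    f-injective i∈ i′∈ eq = trans (sym (g∘f≡id i∈)) (trans (cong g eq) (g∘f≡id i′∈))
    g-into : ∀ {j} → lookup (image f F) j ≡ true → lookup F (g j) ≡ true
    g-into {j} j∈ with image-∈⁻ f F j j∈
    ... | i , i∈ , refl = subst (λ k → lookup F k ≡ true) (sym (g∘f≡id i∈)) i∈
    g-injective : ∀ {j j′} → lookup (image f F) j ≡ true → lookup (image f F) j′ ≡ true → g j ≡ g j′ → j ≡ j′
    g-injective {j} {j′} j∈ j′∈ eq with image-∈⁻ f F j j∈ | image-∈⁻ f F j′ j′∈
    ... | i , i∈ , refl | i′ , i′∈ , refl = cong f (trans (sym (g∘f≡id i∈)) (trans eq (g∘f≡id i′∈)))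
    ≤F : countL (lookup (image f F)) (allFin N) ≤ countL (lookup F) (allFin m)
    ≤F = countL-≤-injection g g-into g-injective (Unique.allFin⁺ N) (λ {j} _ _ → ∈-allFin (g j))
    F≤ : countL (lookup F) (allFin m) ≤ countL (lookup (image f F)) (allFin N)
    F≤ = countL-≤-injection f (image-∈⁺ f F _) f-injective (Unique.allFin⁺ m) (λ {i} _ _ → ∈-allFin (f i))

-- Face counts and joins

link₀ del₀ : ∀ {n} → FaceFn (suc n) → FaceFn n
link₀ K F = K (true ∷ F)
del₀ K F = K (false ∷ F)

-- numFaces d K is faceCount (suc d) K: a d-simplex has d + 1 elements.
faceCount : ∀ {n} → ℕ → FaceFn n → ℕ
faceCount {n} k K = countL (λ F → K F ∧ (∣ F ∣ ≡ᵇ k)) (allSubsets n)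

countL-allSubsets-suc : ∀ n (p : Subset (suc n) → Bool) →
  countL p (allSubsets (suc n)) ≡ countL (p ∘ (true ∷_)) (allSubsets n) + countL (p ∘ (false ∷_)) (allSubsets n)
countL-allSubsets-suc n p = trans (countL-++ p (map (true ∷_) (allSubsets n)) _)
  (cong₂ _+_ (countL-map p (true ∷_) (allSubsets n)) (countL-map p (false ∷_) (allSubsets n)))

faceCount-suc : ∀ {n} k (K : FaceFn (suc n)) → faceCount (suc k) K ≡ faceCount k (link₀ K) + faceCount (suc k) (del₀ K)
faceCount-suc {n} k K = countL-allSubsets-suc n _

faceCount-zero-del₀ : ∀ {n} (K : FaceFn (suc n)) → faceCount 0 K ≡ faceCount 0 (del₀ K)
faceCount-zero-del₀ {n} K = trans (countL-allSubsets-suc n _)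
  (cong (_+ faceCount 0 (del₀ K)) (countL-none (λ F → ∧-zeroʳ (link₀ K F)) (allSubsets n)))

faceCount-zero : ∀ {n} (K : FaceFn n) → faceCount 0 K ≡ indicator (K ⊥)
faceCount-zero {zero} K = cong indicator (∧-identityʳ (K []))
faceCount-zero {suc n} K = trans (faceCount-zero-del₀ K) (faceCount-zero (del₀ K))

numVertices≡faceCount-1 : ∀ {n} (K : FaceFn n) → numVertices K ≡ faceCount 1 K
numVertices≡faceCount-1 {zero} K = cong indicator (sym (∧-zeroʳ (K [])))
numVertices≡faceCount-1 {suc n} K = begin
  numVertices K                                          ≡⟨ countL-allFin-suc n (λ i → K ⁅ i ⁆) ⟩
  indicator (link₀ K ⊥) + numVertices (del₀ K)           ≡⟨ cong₂ _+_ (sym (faceCount-zero (link₀ K))) (numVertices≡faceCount-1 (del₀ K)) ⟩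
  faceCount 0 (link₀ K) + faceCount 1 (del₀ K)           ≡⟨ faceCount-suc 0 K ⟨
  faceCount 1 K                                          ∎
  where open ≡-Reasoning

numVertices≤n : ∀ {n} (K : FaceFn n) → numVertices K ≤ n
numVertices≤n {n} K = ≤-trans (countL-≤-length _ (allFin n)) (≤-reflexive (length-tabulate id))

fullSimplex : ∀ {n} → FaceFn n
fullSimplex _ = true

binomial : ℕ → ℕ → ℕ
binomial n k = faceCount k (fullSimplex {n})

binomial-suc-suc : ∀ n k → binomial (suc n) (suc k) ≡ binomial n k + binomial n (suc k)
binomial-suc-suc n k = faceCount-suc k (fullSimplex {suc n})

binomial-mono : ∀ n k → binomial n k ≤ binomial (suc n) k
binomial-mono n zero = ≤-reflexive (sym (faceCount-zero-del₀ (fullSimplex {suc n})))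
binomial-mono n (suc k) = ≤-trans (m≤n+m _ _) (≤-reflexive (sym (binomial-suc-suc n k)))

-- Pascal's rule for either middle coefficient of row 2q + 3 involves both of row 2q + 1.
3^q≤central-binomial : ∀ q → (3 ^ q ≤ binomial (suc (q + q)) q) × (3 ^ q ≤ binomial (suc (q + q)) (suc q))
3^q≤central-binomial zero = s≤s z≤n , s≤s z≤n
3^q≤central-binomial (suc q) rewrite +-suc q q = at-1+q , at-2+q
  where
  n = suc (q + q)
  ih = 3^q≤central-binomial q
  open ≤-Reasoning
  at-1+q : 3 ^ suc q ≤ binomial (suc (suc n)) (suc q)
  at-1+q = begin
    3 ^ q + (3 ^ q + (3 ^ q + 0))                       ≡⟨ cong (λ x → 3 ^ q + (3 ^ q + x)) (+-identityʳ _) ⟩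
    3 ^ q + (3 ^ q + 3 ^ q)                             ≤⟨ +-mono-≤ (proj₁ ih) (+-mono-≤ (proj₁ ih) (proj₂ ih)) ⟩
    binomial n q + (binomial n q + binomial n (suc q))  ≤⟨ +-mono-≤ (binomial-mono n q) (≤-reflexive (sym (binomial-suc-suc n q))) ⟩
    binomial (suc n) q + binomial (suc n) (suc q)       ≡⟨ binomial-suc-suc (suc n) q ⟨
    binomial (suc (suc n)) (suc q)                      ∎
  at-2+q : 3 ^ suc q ≤ binomial (suc (suc n)) (suc (suc q))
  at-2+q = begin
    3 ^ q + (3 ^ q + (3 ^ q + 0))                                  ≡⟨ cong (λ x → 3 ^ q + (3 ^ q + x)) (+-identityʳ _) ⟩
    3 ^ q + (3 ^ q + 3 ^ q)                                        ≡⟨ +-assoc (3 ^ q) _ _ ⟨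
    (3 ^ q + 3 ^ q) + 3 ^ q                                        ≤⟨ +-mono-≤ (+-mono-≤ (proj₁ ih) (proj₂ ih)) (proj₂ ih) ⟩
    (binomial n q + binomial n (suc q)) + binomial n (suc q)       ≤⟨ +-mono-≤ (≤-reflexive (sym (binomial-suc-suc n q))) (m≤m+n _ _) ⟩
    binomial (suc n) (suc q) + (binomial n (suc q) + binomial n (suc (suc q)))
                                                                   ≡⟨ cong (binomial (suc n) (suc q) +_) (binomial-suc-suc n (suc q)) ⟨
    binomial (suc n) (suc q) + binomial (suc n) (suc (suc q))      ≡⟨ binomial-suc-suc (suc n) (suc q) ⟨
    binomial (suc (suc n)) (suc (suc q))                           ∎

FaceSize≤ : ∀ {n} → ℕ → FaceFn n → Set
FaceSize≤ {n} r K = ∀ (F : Subset n) → K F ≡ true → ∣ F ∣ ≤ r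

complex-vertices : ∀ {n} {K : FaceFn n} → IsComplex K → ∀ {F} → K F ≡ true → ∀ {i} → lookup F i ≡ true → IsVertex K i
complex-vertices (_ , closed) {F} KF {i} i∈F = closed F ⁅ i ⁆ ⁅i⁆⊆F KF
  where
  ⁅i⁆⊆F : ⁅ i ⁆ ⊆ F
  ⁅i⁆⊆F {j} j∈⁅i⁆ with x∈⁅y⁆⇒x≡y i j∈⁅i⁆
  ... | refl = lookup⇒[]= j F i∈F

module _ {a b : ℕ} (K : FaceFn a) (L : FaceFn b) where

  join-∅ : join K L ⊥ ≡ K ⊥ ∧ L ⊥
  join-∅ = cong₂ (λ F G → K F ∧ L G) (take-⊥ a) (drop-⊥ a)

  join-complex : IsComplex K → IsComplex L → IsComplex (join K L)
  join-complex (K∅ , K-closed) (L∅ , L-closed) = trans join-∅ (cong₂ _∧_ K∅ L∅) , closed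
    where
    closed : ∀ F G → G ⊆ F → join K L F ≡ true → join K L G ≡ true
    closed F G G⊆F F∈ = cong₂ _∧_ (K-closed _ _ (take-⊆ a G⊆F) (∧-conicalˡ _ _ F∈))
                                  (L-closed _ _ (drop-⊆ a G⊆F) (∧-conicalʳ _ _ F∈))

  join-face : ∀ {F G} → K F ≡ true → L G ≡ true → join K L (F ++ G) ≡ true
  join-face {F} {G} KF LG = cong₂ _∧_ (trans (cong K (take-++ F G)) KF) (trans (cong L (drop-++ F G)) LG)

  join-FaceSize≤ : ∀ {r r′} → FaceSize≤ r K → FaceSize≤ r′ L → FaceSize≤ (r + r′) (join K L)
  join-FaceSize≤ hK hL H H∈ = ≤-trans (≤-reflexive (∣F∣≡∣take∣+∣drop∣ a H))
    (+-mono-≤ (hK _ (∧-conicalˡ _ _ H∈)) (hL _ (∧-conicalʳ _ _ H∈)))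

  module _ {r r′ : ℕ} (bound : FaceSize≤ (r + r′) (join K L)) where

    join-FaceSize≤ˡ : ∀ {G} → L G ≡ true → ∣ G ∣ ≡ r′ → FaceSize≤ r K
    join-FaceSize≤ˡ {G} LG ∣G∣≡r′ F KF = +-cancelʳ-≤ r′ _ _ (begin
      ∣ F ∣ + r′     ≡⟨ cong (∣ F ∣ +_) ∣G∣≡r′ ⟨
      ∣ F ∣ + ∣ G ∣  ≡⟨ ∣F++G∣≡∣F∣+∣G∣ F G ⟨
      ∣ F ++ G ∣     ≤⟨ bound _ (join-face KF LG) ⟩
      r + r′         ∎)
      where open ≤-Reasoning

    join-FaceSize≤ʳ : ∀ {F} → K F ≡ true → ∣ F ∣ ≡ r → FaceSize≤ r′ L
    join-FaceSize≤ʳ {F} KF ∣F∣≡r G LG = +-cancelˡ-≤ r _ _ (begin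
      r + ∣ G ∣      ≡⟨ cong (_+ ∣ G ∣) ∣F∣≡r ⟨
      ∣ F ∣ + ∣ G ∣  ≡⟨ ∣F++G∣≡∣F∣+∣G∣ F G ⟨
      ∣ F ++ G ∣     ≤⟨ bound _ (join-face KF LG) ⟩
      r + r′         ∎)
      where open ≤-Reasoning

faceCount-join : ∀ {a b} (K : FaceFn a) (L : FaceFn b) {r r′} → FaceSize≤ r K → FaceSize≤ r′ L →
  faceCount (r + r′) (join K L) ≡ faceCount r K * faceCount r′ L
faceCount-join {zero} {b} K L {r} {r′} hK hL with K [] | r
... | false | _ = countL-none (λ _ → refl) (allSubsets b)
... | true | zero = sym (+-identityʳ _)
... | true | suc r = countL-none (λ G → ¬-not (too-big G)) (allSubsets b)
  where
  too-big : ∀ G → (L G ∧ (∣ G ∣ ≡ᵇ suc r + r′)) ≢ true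
  too-big G e = <⇒≱ (m<n+m r′ (s≤s z≤n))
    (subst (_≤ r′) (≡ᵇ-sound (∧-conicalʳ _ _ e)) (hL G (∧-conicalˡ _ _ e)))
faceCount-join {suc a} {b} K L {zero} {r′} hK hL = begin
  faceCount r′ (join K L)                ≡⟨ countL-allSubsets-suc (a + b) _ ⟩
  _ + faceCount r′ (join (del₀ K) L)     ≡⟨ cong (_+ faceCount r′ (join (del₀ K) L)) (countL-none (λ F → ¬-not (no-link F)) (allSubsets (a + b))) ⟩
  faceCount r′ (join (del₀ K) L)         ≡⟨ faceCount-join (del₀ K) L (hK ∘ (false ∷_)) hL ⟩
  faceCount 0 (del₀ K) * faceCount r′ L  ≡⟨ cong (_* faceCount r′ L) (faceCount-zero-del₀ K) ⟨
  faceCount 0 K * faceCount r′ L         ∎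
  where
  open ≡-Reasoning
  no-link : ∀ F → (join K L (true ∷ F) ∧ (suc ∣ F ∣ ≡ᵇ r′)) ≢ true
  no-link F e = n≮0 (hK (true ∷ take a F) (∧-conicalˡ _ _ (∧-conicalˡ _ _ e)))
faceCount-join {suc a} {b} K L {suc r} {r′} hK hL = begin
  faceCount (suc r + r′) (join K L)                             ≡⟨ faceCount-suc (r + r′) (join K L) ⟩
  faceCount (r + r′) (join (link₀ K) L) + faceCount (suc r + r′) (join (del₀ K) L)
                                                                ≡⟨ cong₂ _+_ (faceCount-join (link₀ K) L (λ F → s≤s⁻¹ ∘ hK (true ∷ F)) hL)
                                                                             (faceCount-join (del₀ K) L (hK ∘ (false ∷_)) hL) ⟩
  faceCount r (link₀ K) * X + faceCount (suc r) (del₀ K) * X    ≡⟨ *-distribʳ-+ X (faceCount r (link₀ K)) _ ⟨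
  (faceCount r (link₀ K) + faceCount (suc r) (del₀ K)) * X      ≡⟨ cong (_* X) (faceCount-suc r K) ⟨
  faceCount (suc r) K * X                                       ∎
  where
  open ≡-Reasoning
  X = faceCount r′ L

faceCount-1-join : ∀ {a b} (K : FaceFn a) (L : FaceFn b) → K ⊥ ≡ true → L ⊥ ≡ true →
  faceCount 1 (join K L) ≡ faceCount 1 K + faceCount 1 L
faceCount-1-join {zero} K L K∅ L∅ rewrite K∅ = refl
faceCount-1-join {suc a} K L K∅ L∅ = begin
  faceCount 1 (join K L)                                            ≡⟨ faceCount-suc 0 (join K L) ⟩
  faceCount 0 (join (link₀ K) L) + faceCount 1 (join (del₀ K) L)    ≡⟨ cong₂ _+_ link-part (faceCount-1-join (del₀ K) L K∅ L∅) ⟩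
  faceCount 0 (link₀ K) + (faceCount 1 (del₀ K) + faceCount 1 L)    ≡⟨ +-assoc (faceCount 0 (link₀ K)) _ _ ⟨
  (faceCount 0 (link₀ K) + faceCount 1 (del₀ K)) + faceCount 1 L    ≡⟨ cong (_+ faceCount 1 L) (faceCount-suc 0 K) ⟨
  faceCount 1 K + faceCount 1 L                                     ∎
  where
  open ≡-Reasoning
  link-part : faceCount 0 (join (link₀ K) L) ≡ faceCount 0 (link₀ K)
  link-part = begin
    faceCount 0 (join (link₀ K) L)   ≡⟨ faceCount-zero (join (link₀ K) L) ⟩
    indicator (join (link₀ K) L ⊥)   ≡⟨ cong indicator (trans (join-∅ (link₀ K) L) (cong (link₀ K ⊥ ∧_) L∅)) ⟩
    indicator (link₀ K ⊥ ∧ true)     ≡⟨ cong indicator (∧-identityʳ _) ⟩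
    indicator (link₀ K ⊥)            ≡⟨ faceCount-zero (link₀ K) ⟨
    faceCount 0 (link₀ K)            ∎

-- Nice complexes and their joins

ceilHalf floorHalf : ∀ n → Subset n
ceilHalf zero = []
ceilHalf (suc zero) = true ∷ []
ceilHalf (suc (suc n)) = true ∷ false ∷ ceilHalf n
floorHalf zero = []
floorHalf (suc zero) = false ∷ []
floorHalf (suc (suc n)) = true ∷ false ∷ floorHalf n

∣∁ceilHalf∣≡⌊n/2⌋ : ∀ n → ∣ ∁ (ceilHalf n) ∣ ≡ ⌊ n /2⌋
∣∁ceilHalf∣≡⌊n/2⌋ zero = refl
∣∁ceilHalf∣≡⌊n/2⌋ (suc zero) = refl
∣∁ceilHalf∣≡⌊n/2⌋ (suc (suc n)) = cong suc (∣∁ceilHalf∣≡⌊n/2⌋ n)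

∣floorHalf∣≡⌊n/2⌋ : ∀ n → ∣ floorHalf n ∣ ≡ ⌊ n /2⌋
∣floorHalf∣≡⌊n/2⌋ zero = refl
∣floorHalf∣≡⌊n/2⌋ (suc zero) = refl
∣floorHalf∣≡⌊n/2⌋ (suc (suc n)) = cong suc (∣floorHalf∣≡⌊n/2⌋ n)

floorHalf⊆ceilHalf : ∀ n → floorHalf n ⊆ ceilHalf n
floorHalf⊆ceilHalf (suc zero) (there ())
floorHalf⊆ceilHalf (suc (suc n)) here = here
floorHalf⊆ceilHalf (suc (suc n)) (there (there i∈)) = there (there (floorHalf⊆ceilHalf n i∈))

n≤1+⌊n/2⌋+⌊n/2⌋ : ∀ n → n ≤ suc (⌊ n /2⌋ + ⌊ n /2⌋)
n≤1+⌊n/2⌋+⌊n/2⌋ zero = z≤n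
n≤1+⌊n/2⌋+⌊n/2⌋ (suc zero) = s≤s z≤n
n≤1+⌊n/2⌋+⌊n/2⌋ (suc (suc n)) = s≤s (≤-trans (s≤s (n≤1+⌊n/2⌋+⌊n/2⌋ n)) (s≤s (≤-reflexive (sym (+-suc _ _)))))

nice-halfFace : ∀ {n} {K : FaceFn n} → IsNice K → ∃ λ F → (K F ≡ true) × (∣ F ∣ ≡ ⌊ n /2⌋)
nice-halfFace {n} {K} ((_ , closed) , complementary) with K (∁ (ceilHalf n)) in ∁C∈K
... | true = ∁ (ceilHalf n) , ∁C∈K , ∣∁ceilHalf∣≡⌊n/2⌋ n
... | false = floorHalf n , closed _ _ (floorHalf⊆ceilHalf n) C∈K , ∣floorHalf∣≡⌊n/2⌋ n
  where
  C∈K : K (ceilHalf n) ≡ true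
  C∈K = trans (complementary (ceilHalf n)) (cong not ∁C∈K)

module _ {n q : ℕ} {K : FaceFn n} (n≡1+2q : n ≡ suc (q + q)) (bound : FaceSize≤ q K) where

  nice-odd-faces : IsNice K → ∀ F → ∣ F ∣ ≡ q → K F ≡ true
  nice-odd-faces (_ , complementary) F ∣F∣≡q = trans (complementary F) (cong not (¬-not ∁F∉K))
    where
    ∣∁F∣≡1+q : ∣ ∁ F ∣ ≡ suc q
    ∣∁F∣≡1+q = +-cancelˡ-≡ q _ _ (begin
      q + ∣ ∁ F ∣      ≡⟨ cong (_+ ∣ ∁ F ∣) ∣F∣≡q ⟨
      ∣ F ∣ + ∣ ∁ F ∣  ≡⟨ ∣F∣+∣∁F∣≡n F ⟩
      n                ≡⟨ n≡1+2q ⟩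
      suc (q + q)      ≡⟨ +-suc q q ⟨
      q + suc q        ∎)
      where open ≡-Reasoning
    ∁F∉K : K (∁ F) ≢ true
    ∁F∉K ∁F∈K = 1+n≰n (subst (_≤ q) ∣∁F∣≡1+q (bound (∁ F) ∁F∈K))

  nice-odd-faceCount : IsNice K → 3 ^ q ≤ faceCount q K
  nice-odd-faceCount K-nice = begin
    3 ^ q                           ≤⟨ proj₁ (3^q≤central-binomial q) ⟩
    binomial (suc (q + q)) q        ≡⟨ cong (λ m → binomial m q) n≡1+2q ⟨
    binomial n q                    ≤⟨ countL-mono all-q-sets (allSubsets n) ⟩
    faceCount q K                   ∎
    where
    open ≤-Reasoning
    all-q-sets : ∀ {F} → (∣ F ∣ ≡ᵇ q) ≡ true → (K F ∧ (∣ F ∣ ≡ᵇ q)) ≡ true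
    all-q-sets {F} ∣F∣≡q = cong₂ _∧_ (nice-odd-faces K-nice F (≡ᵇ-sound ∣F∣≡q)) ∣F∣≡q

odd-faceCount-1 : ∀ {n} q {K : FaceFn n} → n ≡ suc (q + q) → FaceSize≤ q K → faceCount 1 K ≤ 3 * q
odd-faceCount-1 {n} zero {K} _ bound = ≤-reflexive (countL-none (λ F → ¬-not (no-vertex F)) (allSubsets n))
  where
  no-vertex : ∀ F → (K F ∧ (∣ F ∣ ≡ᵇ 1)) ≢ true
  no-vertex F e = 1+n≰n (subst (_≤ 0) (≡ᵇ-sound (∧-conicalʳ _ _ e)) (bound F (∧-conicalˡ _ _ e)))
odd-faceCount-1 {n} (suc q) {K} n≡1+2q _ = begin
  faceCount 1 K                ≡⟨ numVertices≡faceCount-1 K ⟨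
  numVertices K                ≤⟨ numVertices≤n K ⟩
  n                            ≡⟨ n≡1+2q ⟩
  suc (suc q + suc q)          ≤⟨ +-monoˡ-≤ (suc q + suc q) (s≤s z≤n) ⟩
  suc q + (suc q + suc q)      ≡⟨ cong (λ x → suc q + (suc q + x)) (+-identityʳ (suc q)) ⟨
  3 * suc q                    ∎
  where open ≤-Reasoning

AllNice : List (Σ ℕ FaceFn) → Set
AllNice = All (λ c → IsNice (proj₂ c))

halfSize : List (Σ ℕ FaceFn) → ℕ
halfSize [] = 0
halfSize ((n , _) ∷ cs) = ⌊ n /2⌋ + halfSize cs

joinAll-complex : ∀ cs → AllNice cs → IsComplex (joinAll cs)
joinAll-complex [] _ = refl , λ _ _ _ _ → refl
joinAll-complex ((_ , K) ∷ cs) (K-nice ∷ cs-nice) = join-complex K (joinAll cs) (proj₁ K-nice) (joinAll-complex cs cs-nice)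

joinAll-halfFace : ∀ cs → AllNice cs → ∃ λ F → (joinAll cs F ≡ true) × (∣ F ∣ ≡ halfSize cs)
joinAll-halfFace [] _ = [] , refl , refl
joinAll-halfFace ((_ , K) ∷ cs) (K-nice ∷ cs-nice) with nice-halfFace K-nice | joinAll-halfFace cs cs-nice
... | F , F∈K , ∣F∣≡ | G , G∈J , ∣G∣≡ = F ++ G , join-face K (joinAll cs) F∈K G∈J , trans (∣F++G∣≡∣F∣+∣G∣ F G) (cong₂ _+_ ∣F∣≡ ∣G∣≡)

regroup-halves : ∀ q Q s → suc (q + q) + ((Q + Q) + s) ≡ ((q + Q) + (q + Q)) + suc s
regroup-halves = solve-∀

sizes≤2halfSize+length : ∀ cs → sizes cs ≤ (halfSize cs + halfSize cs) + length cs
sizes≤2halfSize+length [] = z≤n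
sizes≤2halfSize+length ((n , _) ∷ cs) = begin
  n + sizes cs                                         ≤⟨ +-mono-≤ (n≤1+⌊n/2⌋+⌊n/2⌋ n) (sizes≤2halfSize+length cs) ⟩
  suc (⌊ n /2⌋ + ⌊ n /2⌋) + ((Q + Q) + length cs)      ≡⟨ regroup-halves ⌊ n /2⌋ Q (length cs) ⟩
  ((⌊ n /2⌋ + Q) + (⌊ n /2⌋ + Q)) + suc (length cs)    ∎
  where
  open ≤-Reasoning
  Q = halfSize cs

+-≤-tight : ∀ {a b x y} → a ≤ x → b ≤ y → a + b ≡ x + y → (a ≡ x) × (b ≡ y)
+-≤-tight {a} {b} {x} {y} a≤x b≤y eq = ≤-antisym a≤x x≤a , ≤-antisym b≤y y≤b
  where
  x≤a : x ≤ a
  x≤a = +-cancelʳ-≤ y x a (≤-trans (≤-reflexive (sym eq)) (+-monoʳ-≤ a b≤y))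
  y≤b : y ≤ b
  y≤b = +-cancelˡ-≤ x y b (≤-trans (≤-reflexive (sym eq)) (+-monoˡ-≤ b a≤x))

nice-joinAll-faceCounts : ∀ cs → AllNice cs → sizes cs ≡ (halfSize cs + halfSize cs) + length cs →
  FaceSize≤ (halfSize cs) (joinAll cs) →
  (3 ^ halfSize cs ≤ faceCount (halfSize cs) (joinAll cs)) × (faceCount 1 (joinAll cs) ≤ 3 * halfSize cs)
nice-joinAll-faceCounts [] _ _ _ = s≤s z≤n , z≤n
nice-joinAll-faceCounts ((n , K) ∷ cs) (K-nice ∷ cs-nice) size-eq bound
  -- Σ n ≤ Σ (1 + 2⌊n/2⌋) is an equality, hence one in each factor: n is odd.
  with +-≤-tight (n≤1+⌊n/2⌋+⌊n/2⌋ n) (sizes≤2halfSize+length cs)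
                 (trans size-eq (sym (regroup-halves ⌊ n /2⌋ (halfSize cs) (length cs))))
... | n≡1+2q , cs-size-eq = faces , vertices
  where
  q = ⌊ n /2⌋
  Q = halfSize cs
  J = joinAll cs
  K-bound : FaceSize≤ q K
  K-bound = let (G , G∈J , ∣G∣≡Q) = joinAll-halfFace cs cs-nice in join-FaceSize≤ˡ K J bound G∈J ∣G∣≡Q
  J-bound : FaceSize≤ Q J
  J-bound = let (F , F∈K , ∣F∣≡q) = nice-halfFace K-nice in join-FaceSize≤ʳ K J bound F∈K ∣F∣≡q
  ih = nice-joinAll-faceCounts cs cs-nice cs-size-eq J-bound
  open ≤-Reasoning
  faces : 3 ^ (q + Q) ≤ faceCount (q + Q) (join K J)
  faces = begin
    3 ^ (q + Q)                    ≡⟨ ^-distribˡ-+-* 3 q Q ⟩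
    3 ^ q * 3 ^ Q                  ≤⟨ *-mono-≤ (nice-odd-faceCount n≡1+2q K-bound K-nice) (proj₁ ih) ⟩
    faceCount q K * faceCount Q J  ≡⟨ faceCount-join K J K-bound J-bound ⟨
    faceCount (q + Q) (join K J)   ∎
  vertices : faceCount 1 (join K J) ≤ 3 * (q + Q)
  vertices = begin
    faceCount 1 (join K J)         ≡⟨ faceCount-1-join K J (proj₁ (proj₁ K-nice)) (proj₁ (joinAll-complex cs cs-nice)) ⟩
    faceCount 1 K + faceCount 1 J  ≤⟨ +-mono-≤ (odd-faceCount-1 q n≡1+2q K-bound) (proj₂ ih) ⟩
    3 * q + 3 * Q                  ≡⟨ *-distribˡ-+ 3 q Q ⟨
    3 * (q + Q)                    ∎

-- Isomorphic (d+1)-graphs and the class 𝓕_d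

module _ {m N d : ℕ} {K : FaceFn m} {J : FaceFn N} where

  HypIso-numVertices : HypIso d K J → numVertices K ≤ numVertices J
  HypIso-numVertices (f , g , f-vertex , _ , _) =
    countL-≤-injection f (λ v → proj₁ (f-vertex _ v)) f-injective (Unique.allFin⁺ m) (λ {i} _ _ → ∈-allFin (f i))
    where
    f-injective : ∀ {i i′} → IsVertex K i → IsVertex K i′ → f i ≡ f i′ → i ≡ i′
    f-injective v v′ eq = trans (sym (proj₂ (f-vertex _ v))) (trans (cong g eq) (proj₂ (f-vertex _ v′)))

  HypIso-numFaces : HypIso d K J → IsComplex J → numFaces d J ≤ numFaces d K
  HypIso-numFaces (f , g , _ , g-vertex , faces-agree) J-complex =
    countL-≤-injection (image g) face↦face image-injective (allSubsets-unique N)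
      (λ {G} _ _ → allSubsets-complete (image g G))
    where
    f∘g≡id : ∀ {G} → J G ≡ true → ∀ {j} → lookup G j ≡ true → f (g j) ≡ j
    f∘g≡id G∈J j∈G = proj₂ (g-vertex _ (complex-vertices J-complex G∈J j∈G))
    face↦face : ∀ {G} → (J G ∧ (∣ G ∣ ≡ᵇ suc d)) ≡ true → (K (image g G) ∧ (∣ image g G ∣ ≡ᵇ suc d)) ≡ true
    face↦face {G} e = cong₂ _∧_ K-face (trans (cong (_≡ᵇ suc d) ∣gG∣≡∣G∣) (∧-conicalʳ _ _ e))
      where
      G∈J = ∧-conicalˡ _ _ e
      ∣gG∣≡∣G∣ = ∣image∣≡∣F∣ g f {G} (f∘g≡id G∈J)
      vertices : ∀ i → lookup (image g G) i ≡ true → IsVertex K i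
      vertices i i∈ with image-∈⁻ g G i i∈
      ... | j , j∈G , refl = proj₁ (g-vertex j (complex-vertices J-complex G∈J j∈G))
      K-face : K (image g G) ≡ true
      K-face = begin
        K (image g G)              ≡⟨ faces-agree (image g G) vertices (trans ∣gG∣≡∣G∣ (≡ᵇ-sound (∧-conicalʳ _ _ e))) ⟩
        J (image f (image g G))    ≡⟨ cong J (image-cancel g f {G} (f∘g≡id G∈J)) ⟩
        J G                        ≡⟨ G∈J ⟩
        true                       ∎
        where open ≡-Reasoning
    image-injective : ∀ {G G′} → (J G ∧ (∣ G ∣ ≡ᵇ suc d)) ≡ true → (J G′ ∧ (∣ G′ ∣ ≡ᵇ suc d)) ≡ true →
      image g G ≡ image g G′ → G ≡ G′
    image-injective {G} {G′} e e′ eq = trans (sym (image-cancel g f {G} (f∘g≡id (∧-conicalˡ _ _ e))))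
      (trans (cong (image f) eq) (image-cancel g f {G′} (f∘g≡id (∧-conicalˡ _ _ e′))))

HypIso-refl : ∀ {m} d (K : FaceFn m) → HypIso d K K
HypIso-refl d K = id , id , (λ _ v → v , refl) , (λ _ v → v , refl) , (λ F _ _ → cong K (sym (image-id F)))

2d+s+2≡[1+d]+[1+d]+s : ∀ d s → 2 * d + s + 2 ≡ (suc d + suc d) + s
2d+s+2≡[1+d]+[1+d]+s = solve-∀

m+m≤n+n⇒m≤n : ∀ {m n} → m + m ≤ n + n → m ≤ n
m+m≤n+n⇒m≤n m+m≤n+n = ≮⇒≥ (λ n<m → <⇒≱ (+-mono-< n<m n<m) m+m≤n+n)

InFd-halfSize : ∀ {d cs} → AllNice cs → HasDim d (joinAll cs) → sizes cs ≡ 2 * d + length cs + 2 →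
  halfSize cs ≡ suc d
InFd-halfSize {d} {cs} cs-nice (_ , bound) size-eq = ≤-antisym Q≤1+d 1+d≤Q
  where
  Q = halfSize cs
  Q≤1+d : Q ≤ suc d
  Q≤1+d = let (F , F∈J , ∣F∣≡Q) = joinAll-halfFace cs cs-nice in subst (_≤ suc d) ∣F∣≡Q (bound F F∈J)
  1+d≤Q : suc d ≤ Q
  1+d≤Q = m+m≤n+n⇒m≤n (+-cancelʳ-≤ (length cs) _ _ (begin
    (suc d + suc d) + length cs   ≡⟨ 2d+s+2≡[1+d]+[1+d]+s d (length cs) ⟨
    2 * d + length cs + 2         ≡⟨ size-eq ⟨
    sizes cs                      ≤⟨ sizes≤2halfSize+length cs ⟩
    (Q + Q) + length cs           ∎))
    where open ≤-Reasoning

InFd-counts : ∀ {m d} {K : FaceFn m} → InFd d K → (numVertices K ≤ 3 * suc d) × (3 ^ suc d ≤ numFaces d K)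
InFd-counts {d = d} {K} (cs , _ , cs-nice , dim , size-eq , iso) = vertices , faces
  where
  J = joinAll cs
  Q≡1+d = InFd-halfSize cs-nice dim size-eq
  counts : (3 ^ halfSize cs ≤ faceCount (halfSize cs) J) × (faceCount 1 J ≤ 3 * halfSize cs)
  counts = nice-joinAll-faceCounts cs cs-nice
    (trans size-eq (trans (2d+s+2≡[1+d]+[1+d]+s d (length cs)) (cong (λ Q → (Q + Q) + length cs) (sym Q≡1+d))))
    (subst (λ Q → FaceSize≤ Q J) (sym Q≡1+d) (proj₂ dim))
  open ≤-Reasoning
  vertices : numVertices K ≤ 3 * suc d
  vertices = begin
    numVertices K           ≤⟨ HypIso-numVertices {J = J} iso ⟩
    numVertices J           ≡⟨ numVertices≡faceCount-1 J ⟩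
    faceCount 1 J           ≤⟨ proj₂ counts ⟩
    3 * halfSize cs         ≡⟨ cong (3 *_) Q≡1+d ⟩
    3 * suc d               ∎
  faces : 3 ^ suc d ≤ numFaces d K
  faces = begin
    3 ^ suc d                    ≡⟨ cong (3 ^_) Q≡1+d ⟨
    3 ^ halfSize cs              ≤⟨ proj₁ counts ⟩
    faceCount (halfSize cs) J    ≡⟨ cong (λ Q → faceCount Q J) Q≡1+d ⟩
    numFaces d J                 ≤⟨ HypIso-numFaces {J = J} iso (joinAll-complex cs cs-nice) ⟩
    numFaces d K                 ∎

-- The extremal complex ((Δ₂)^{≤0})^{*(d+1)}

Δ₂⁰-FaceSize≤ : FaceSize≤ 1 Delta2-0
Δ₂⁰-FaceSize≤ F F∈ = ≤ᵇ⇒≤ ∣ F ∣ 1 (Equivalence.from T-≡ F∈)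

Δ₂⁰-nice : IsNice Delta2-0
Δ₂⁰-nice = (refl , closed) , complementary
  where
  closed : ∀ F G → G ⊆ F → Delta2-0 F ≡ true → Delta2-0 G ≡ true
  closed F G G⊆F F∈ = Equivalence.to T-≡ (≤⇒≤ᵇ (≤-trans (p⊆q⇒∣p∣≤∣q∣ G⊆F) (Δ₂⁰-FaceSize≤ F F∈)))
  complementary : ∀ F → Delta2-0 F ≡ not (Delta2-0 (∁ F))
  complementary (true ∷ true ∷ true ∷ []) = refl
  complementary (true ∷ true ∷ false ∷ []) = refl
  complementary (true ∷ false ∷ true ∷ []) = refl
  complementary (true ∷ false ∷ false ∷ []) = refl
  complementary (false ∷ true ∷ true ∷ []) = refl
  complementary (false ∷ true ∷ false ∷ []) = refl
  complementary (false ∷ false ∷ true ∷ []) = refl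
  complementary (false ∷ false ∷ false ∷ []) = refl

Δ₂⁰-copies : ℕ → List (Σ ℕ FaceFn)
Δ₂⁰-copies k = replicate k (3 , Delta2-0)

Δ₂⁰-copies-nice : ∀ k → AllNice (Δ₂⁰-copies k)
Δ₂⁰-copies-nice zero = []
Δ₂⁰-copies-nice (suc k) = Δ₂⁰-nice ∷ Δ₂⁰-copies-nice k

halfSize-Δ₂⁰-copies : ∀ k → halfSize (Δ₂⁰-copies k) ≡ k
halfSize-Δ₂⁰-copies zero = refl
halfSize-Δ₂⁰-copies (suc k) = cong suc (halfSize-Δ₂⁰-copies k)

sizes-Δ₂⁰-copies : ∀ k → sizes (Δ₂⁰-copies k) ≡ 3 * k
sizes-Δ₂⁰-copies zero = refl
sizes-Δ₂⁰-copies (suc k) = trans (cong (3 +_) (sizes-Δ₂⁰-copies k)) (sym (*-suc 3 k))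

Δ₂⁰-copies-FaceSize≤ : ∀ k → FaceSize≤ k (joinAll (Δ₂⁰-copies k))
Δ₂⁰-copies-FaceSize≤ zero [] _ = z≤n
Δ₂⁰-copies-FaceSize≤ (suc k) = join-FaceSize≤ Delta2-0 (joinAll (Δ₂⁰-copies k)) Δ₂⁰-FaceSize≤ (Δ₂⁰-copies-FaceSize≤ k)

Δ₂⁰-copies-faceCount-top : ∀ k → faceCount k (joinAll (Δ₂⁰-copies k)) ≡ 3 ^ k
Δ₂⁰-copies-faceCount-top zero = refl
Δ₂⁰-copies-faceCount-top (suc k) = trans (faceCount-join Delta2-0 (joinAll (Δ₂⁰-copies k)) Δ₂⁰-FaceSize≤ (Δ₂⁰-copies-FaceSize≤ k))
                                     (cong (3 *_) (Δ₂⁰-copies-faceCount-top k))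

Δ₂⁰-copies-faceCount-1 : ∀ k → faceCount 1 (joinAll (Δ₂⁰-copies k)) ≡ 3 * k
Δ₂⁰-copies-faceCount-1 zero = refl
Δ₂⁰-copies-faceCount-1 (suc k) = begin
  faceCount 1 (joinAll (Δ₂⁰-copies (suc k)))  ≡⟨ faceCount-1-join Delta2-0 (joinAll (Δ₂⁰-copies k)) refl (proj₁ (joinAll-complex _ (Δ₂⁰-copies-nice k))) ⟩
  3 + faceCount 1 (joinAll (Δ₂⁰-copies k))    ≡⟨ cong (3 +_) (Δ₂⁰-copies-faceCount-1 k) ⟩
  3 + 3 * k                               ≡⟨ *-suc 3 k ⟨
  3 * suc k                               ∎
  where open ≡-Reasoning

L*-numVertices : ∀ d → numVertices (L* d) ≡ 3 * suc d
L*-numVertices d = trans (numVertices≡faceCount-1 (L* d)) (Δ₂⁰-copies-faceCount-1 (suc d))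

L*-numFaces : ∀ d → numFaces d (L* d) ≡ 3 ^ suc d
L*-numFaces d = Δ₂⁰-copies-faceCount-top (suc d)

L*-HasDim : ∀ d → HasDim d (L* d)
L*-HasDim d with joinAll-halfFace (Δ₂⁰-copies (suc d)) (Δ₂⁰-copies-nice (suc d))
... | F , F∈L , ∣F∣≡ = (F , F∈L , trans ∣F∣≡ (halfSize-Δ₂⁰-copies (suc d))) , Δ₂⁰-copies-FaceSize≤ (suc d)

3[1+d]≡2d+[1+d]+2 : ∀ d → 3 * suc d ≡ 2 * d + suc d + 2
3[1+d]≡2d+[1+d]+2 = solve-∀

L*-InFd : ∀ d → InFd d (L* d)
L*-InFd d = Δ₂⁰-copies (suc d) , s≤s z≤n , Δ₂⁰-copies-nice (suc d) , L*-HasDim d , size-eq , HypIso-refl d (L* d)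
  where
  size-eq : sizes (Δ₂⁰-copies (suc d)) ≡ 2 * d + length (Δ₂⁰-copies (suc d)) + 2
  size-eq = begin
    sizes (Δ₂⁰-copies (suc d))                 ≡⟨ sizes-Δ₂⁰-copies (suc d) ⟩
    3 * suc d                              ≡⟨ 3[1+d]≡2d+[1+d]+2 d ⟩
    2 * d + suc d + 2                      ≡⟨ cong (λ s → 2 * d + s + 2) (length-replicate (suc d)) ⟨
    2 * d + length (Δ₂⁰-copies (suc d)) + 2    ∎
    where open ≡-Reasoning

mainTheorem16 : ∀ (d : ℕ) → 1 ≤ d →
    (IsComplex (L* d) × HasDim d (L* d) × InFd d (L* d))
    × (∀ (m : ℕ) (K : FaceFn m) → IsComplex K → HasDim d K → InFd d K →
         (numVertices K ≤ numVertices (L* d)) × (numFaces d (L* d) ≤ numFaces d K))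
mainTheorem16 d _ = (joinAll-complex _ (Δ₂⁰-copies-nice (suc d)) , L*-HasDim d , L*-InFd d) , extremal
  where
  extremal : ∀ m (K : FaceFn m) → IsComplex K → HasDim d K → InFd d K →
    (numVertices K ≤ numVertices (L* d)) × (numFaces d (L* d) ≤ numFaces d K)
  extremal _ _ _ _ K∈𝓕 = ≤-trans (proj₁ (InFd-counts K∈𝓕)) (≤-reflexive (sym (L*-numVertices d)))
                        , ≤-trans (≤-reflexive (L*-numFaces d)) (proj₂ (InFd-counts K∈𝓕))
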